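{- Let $a$ be a positive integer and let $p, q \in [0,1]$ with $p < \frac{1-q}{2}$. Let $f: [2a] \to \mathbb{Q}$ be a map such that (1) $|Z(f)| \leq qa$, where $Z(f) := \{x \in [a] \mid f(x) = 0\}$, and (2) $|NP(f)| \leq pa$, where $NP(f) := \{x \in [a] \mid f(x+a) \neq f(x)\}$. Then \[ |P(f)| \geq \frac{(1-q-2p)^2}{4} a^2 + \frac{1-q-2p}{2} a, \] where $P(f) := \{(x,y) \in [a] \times [a] \mid f(x+y) \neq f(x) + f(y)\}$.
   Context: For a positive integer $m$, $[m]$ denotes the set $\{1, 2, \ldots, m\}$.
   Formalization: The parameters p and q range over the rationals in [0,1]. -}

module Defs where

open import Data.Nat using (ℕ; suc; _+_)
open import Data.Integer using (+_)
open import Data.Product using (_×_; _,_)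
open import Data.List using (List; applyUpTo; filter; cartesianProduct; length)
open import Data.Rational using (ℚ; _/_; 0ℚ) renaming (_+_ to _+ℚ_)
open import Data.Rational.Properties using (_≟_)
open import Relation.Nullary.Decidable using (¬?)

toℚ : ℕ → ℚ
toℚ n = (+ n) / 1

interval : ℕ → List ℕ
interval a = applyUpTo suc a

Z : (ℕ → ℚ) → ℕ → List ℕ
Z f a = filter (λ x → f x ≟ 0ℚ) (interval a)

NP : (ℕ → ℚ) → ℕ → List ℕ
NP f a = filter (λ x → ¬? (f (x + a) ≟ f x)) (interval a)

P : (ℕ → ℚ) → ℕ → List (ℕ × ℕ)
P f a = filter (λ { (x , y) → ¬? (f (x + y) ≟ (f x +ℚ f y)) })
               (cartesianProduct (interval a) (interval a))

module Submission where

-- Split [a] by the sign of f and fix a row x. If f(y) > 0 and f(x + y) = f(x) + f(y), then the point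
-- x + y, reduced mod a, either lies in NP(f) or carries a value larger than f(x). Hence row x contains at
-- least |Pos| - |NP| - r(x) pairs of P(f) with f(y) > 0, where r(x) counts the z with f(z) > f(x), and
-- summing with the rank inequality  sum_x max(0, k - r(x)) >= k(k+1)/2  gives at least u(u+1)/2 such pairs,
-- u = |Pos| - |NP|. The same holds for the negative values (apply it to -f), so W = u + v satisfies
-- W(W+2) <= 4|P(f)|. Finally a = |Pos| + |Neg| + |Z| <= W + |Z| + 2|NP| <= W + (q + 2p)a, i.e. W >= (1 - q - 2p)a.

module Combinatorics where
  open import Data.Bool.Base using (true; false; if_then_else_)
  open import Data.Empty using (⊥)
  open import Data.List.Base using (List; []; _∷_; _++_; map; length; filter; applyUpTo; cartesianProduct)
  open import Data.List.Properties using (map-++; map-cong; map-∘; length-applyUpTo)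
  open import Data.List.Membership.Propositional using (_∈_)
  open import Data.List.Membership.Propositional.Properties using (∈-applyUpTo⁻)
  open import Data.List.Relation.Unary.All as All using (All; []; _∷_)
  open import Data.List.Relation.Unary.Any using (here; there)
  open import Data.List.Relation.Binary.Permutation.Propositional using (_↭_; prep; swap; ↭-refl; ↭-trans)
  open import Data.List.Relation.Binary.Permutation.Propositional.Properties using (map⁺; ↭-length)
  open import Data.Nat.Base using (ℕ; zero; suc; _+_; _*_; _∸_; _≤_; z≤n; s≤s; s≤s⁻¹)
  open import Data.Nat.ListAction using (sum)
  open import Data.Nat.ListAction.Properties using (sum-++; sum-↭)
  open import Data.Nat.Properties
  open import Algebra.Properties.CommutativeSemigroup +-commutativeSemigroup using (interchange)
  open import Data.Nat.Tactic.RingSolver using (solve-∀)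
  open import Data.Product.Base using (_×_; _,_; ∃₂; proj₂)
  open import Data.Rational.Base as ℚ using (ℚ; 0ℚ)
  import Data.Rational.Properties as ℚ
  open import Data.Sum.Base using (_⊎_; inj₁; inj₂)
  open import Function.Base using (_∘_)
  open import Level using (Level)
  open import Relation.Binary.Core using (Rel)
  open import Relation.Binary.Definitions as B using (Transitive; tri<; tri≈; tri>)
  open import Relation.Binary.PropositionalEquality using (_≡_; refl; sym; trans; cong; cong₂; subst; subst₂)
  open import Relation.Nullary using (¬_; Dec; yes; no; does; _×-dec_; _⊎-dec_; ¬?; contradiction)
  open import Relation.Unary using (Pred; Decidable; ∁; _⊆_)
  open import Relation.Unary.Properties using (∁?; _∩?_; _∪?_)

  open import Defs

  private variable
    ℓ ℓ′ ℓ″ : Level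
    A B : Set

  ∑ : (A → ℕ) → List A → ℕ
  ∑ g xs = sum (map g xs)

  ∑-cong : ∀ {g h : A → ℕ} → (∀ x → g x ≡ h x) → ∀ xs → ∑ g xs ≡ ∑ h xs
  ∑-cong g≗h xs = cong sum (map-cong g≗h xs)

  ∑-mono-≤ : ∀ {g h : A → ℕ} xs → (∀ {x} → x ∈ xs → g x ≤ h x) → ∑ g xs ≤ ∑ h xs
  ∑-mono-≤ []       g≤h = z≤n
  ∑-mono-≤ (x ∷ xs) g≤h = +-mono-≤ (g≤h (here refl)) (∑-mono-≤ xs (g≤h ∘ there))

  ∑-+ : ∀ (g h : A → ℕ) xs → ∑ (λ x → g x + h x) xs ≡ ∑ g xs + ∑ h xs
  ∑-+ g h []       = refl
  ∑-+ g h (x ∷ xs) = trans (cong (g x + h x +_) (∑-+ g h xs)) (interchange (g x) (h x) (∑ g xs) (∑ h xs))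

  ∑-++ : ∀ (g : A → ℕ) xs ys → ∑ g (xs ++ ys) ≡ ∑ g xs + ∑ g ys
  ∑-++ g xs ys = trans (cong sum (map-++ g xs ys)) (sum-++ (map g xs) (map g ys))

  ∑-map : ∀ (g : B → ℕ) (h : A → B) xs → ∑ g (map h xs) ≡ ∑ (g ∘ h) xs
  ∑-map g h xs = cong sum (sym (map-∘ xs))

  ∑-↭ : ∀ (g : A → ℕ) {xs ys} → xs ↭ ys → ∑ g xs ≡ ∑ g ys
  ∑-↭ g xs↭ys = sum-↭ (map⁺ g xs↭ys)

  𝟙 : {P : Set ℓ} → Dec P → ℕ
  𝟙 P? = if does P? then 1 else 0

  𝟙≤1 : {P : Set ℓ} (P? : Dec P) → 𝟙 P? ≤ 1
  𝟙≤1 (yes _) = ≤-refl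
  𝟙≤1 (no _)  = z≤n

  𝟙-mono-≤ : {P : Set ℓ} {Q : Set ℓ′} (P? : Dec P) (Q? : Dec Q) → (P → Q) → 𝟙 P? ≤ 𝟙 Q?
  𝟙-mono-≤ (yes p) (yes _) _   = ≤-refl
  𝟙-mono-≤ (yes p) (no ¬q) P⇒Q = contradiction (P⇒Q p) ¬q
  𝟙-mono-≤ (no _)  _       _   = z≤n

  module _ {P : Set ℓ} {Q : Set ℓ′} where

    𝟙-⊎ : (P? : Dec P) (Q? : Dec Q) → 𝟙 (P? ⊎-dec Q?) ≤ 𝟙 P? + 𝟙 Q?
    𝟙-⊎ (yes _) _ = s≤s z≤n
    𝟙-⊎ (no _)  _ = ≤-refl

    𝟙-split : (P? : Dec P) (Q? : Dec Q) → 𝟙 P? ≡ 𝟙 (P? ×-dec Q?) + 𝟙 (P? ×-dec ¬? Q?)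
    𝟙-split (yes _) (yes _) = refl
    𝟙-split (yes _) (no _)  = refl
    𝟙-split (no _)  _       = refl

    𝟙-disjoint : {R : Set ℓ″} (P? : Dec P) (Q? : Dec Q) (R? : Dec R) →
                 (P → Q → ⊥) → (P → R) → (Q → R) → 𝟙 P? + 𝟙 Q? ≤ 𝟙 R?
    𝟙-disjoint (yes p) (yes q) _       disj _   _   = contradiction q (disj p)
    𝟙-disjoint (yes p) (no _)  R?      _    P⇒R _   = 𝟙-mono-≤ (yes p) R? P⇒R
    𝟙-disjoint (no _)  Q?      R?      _    _   Q⇒R = 𝟙-mono-≤ Q? R? Q⇒R

  count : {P : Pred A ℓ} → Decidable P → List A → ℕ
  count P? = ∑ (λ x → 𝟙 (P? x))

  module _ {P : Pred A ℓ} (P? : Decidable P) where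

    length-filter≡count : ∀ xs → length (filter P? xs) ≡ count P? xs
    length-filter≡count []       = refl
    length-filter≡count (x ∷ xs) with does (P? x)
    ... | true  = cong suc (length-filter≡count xs)
    ... | false = length-filter≡count xs

    count-none : ∀ {xs} → All (∁ P) xs → count P? xs ≡ 0
    count-none []                   = refl
    count-none {x ∷ _} (¬px ∷ ¬pxs) with P? x
    ... | yes px = contradiction px ¬px
    ... | no  _  = count-none ¬pxs

    count-universal : (∀ x → P x) → ∀ xs → count P? xs ≡ length xs
    count-universal all []       = refl
    count-universal all (x ∷ xs) with P? x
    ... | yes _  = cong suc (count-universal all xs)
    ... | no ¬px = contradiction (all x) ¬px

    count-mono-≤ : {Q : Pred A ℓ′} (Q? : Decidable Q) → P ⊆ Q → ∀ xs → count P? xs ≤ count Q? xs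
    count-mono-≤ Q? P⊆Q xs = ∑-mono-≤ xs (λ {x} _ → 𝟙-mono-≤ (P? x) (Q? x) P⊆Q)

    count≤length : ∀ xs → count P? xs ≤ length xs
    count≤length []       = z≤n
    count≤length (x ∷ xs) = +-mono-≤ (𝟙≤1 (P? x)) (count≤length xs)

    module _ {Q : Pred A ℓ′} (Q? : Decidable Q) where

      count-∪ : ∀ xs → count (P? ∪? Q?) xs ≤ count P? xs + count Q? xs
      count-∪ xs = ≤-trans (∑-mono-≤ xs (λ {x} _ → 𝟙-⊎ (P? x) (Q? x)))
                           (≤-reflexive (∑-+ (𝟙 ∘ P?) (𝟙 ∘ Q?) xs))

      count-split : ∀ xs → count P? xs ≡ count (P? ∩? Q?) xs + count (P? ∩? ∁? Q?) xs
      count-split xs = trans (∑-cong (λ x → 𝟙-split (P? x) (Q? x)) xs)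
                             (∑-+ (𝟙 ∘ (P? ∩? Q?)) (𝟙 ∘ (P? ∩? ∁? Q?)) xs)

      count-disjoint : {R : Pred A ℓ″} (R? : Decidable R) → (∀ {x} → P x → Q x → ⊥) →
                       P ⊆ R → Q ⊆ R → ∀ xs → count P? xs + count Q? xs ≤ count R? xs
      count-disjoint R? disj P⊆R Q⊆R xs =
        ≤-trans (≤-reflexive (sym (∑-+ (𝟙 ∘ P?) (𝟙 ∘ Q?) xs)))
                (∑-mono-≤ xs (λ {x} _ → 𝟙-disjoint (P? x) (Q? x) (R? x) disj P⊆R Q⊆R))

  count-cartesianProduct : ∀ {P : Pred (A × B) ℓ} (P? : Decidable P) xs ys →
    count P? (cartesianProduct xs ys) ≡ ∑ (λ x → count (λ y → P? (x , y)) ys) xs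
  count-cartesianProduct P? []       ys = refl
  count-cartesianProduct P? (x ∷ xs) ys =
    trans (∑-++ (𝟙 ∘ P?) (map (x ,_) ys) (cartesianProduct xs ys))
          (cong₂ _+_ (∑-map (𝟙 ∘ P?) (x ,_) ys) (count-cartesianProduct P? xs ys))

  applyUpTo-+ : ∀ (g : ℕ → A) m n → applyUpTo g (m + n) ≡ applyUpTo g m ++ applyUpTo (λ i → g (m + i)) n
  applyUpTo-+ g zero    n = refl
  applyUpTo-+ g (suc m) n = cong (g 0 ∷_) (applyUpTo-+ (g ∘ suc) m n)

  module _ {P : Pred A ℓ} {Q : Pred B ℓ′} (P? : Decidable P) (Q? : Decidable Q) where

    count-applyUpTo-mono-≤ : ∀ {g h} → (∀ i → P (g i) → Q (h i)) → ∀ n →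
                             count P? (applyUpTo g n) ≤ count Q? (applyUpTo h n)
    count-applyUpTo-mono-≤ P⇒Q zero    = z≤n
    count-applyUpTo-mono-≤ P⇒Q (suc n) =
      +-mono-≤ (𝟙-mono-≤ (P? _) (Q? _) (P⇒Q 0)) (count-applyUpTo-mono-≤ (P⇒Q ∘ suc) n)

  module _ {P : Pred ℕ ℓ} {Q : Pred ℕ ℓ′} (P? : Decidable P) (Q? : Decidable Q) where

    count-interval-rotate : ∀ m n → (∀ i → P (suc i) → Q (suc (n + i))) →
                            (∀ i → P (suc (m + i)) → Q (suc i)) →
                            count P? (interval (m + n)) ≤ count Q? (interval (n + m))
    count-interval-rotate m n head⇒ tail⇒ = begin
      count P? (interval (m + n))
        ≡⟨ cong (count P?) (applyUpTo-+ suc m n) ⟩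
      count P? (interval m ++ applyUpTo (λ i → suc (m + i)) n)
        ≡⟨ ∑-++ (𝟙 ∘ P?) (interval m) _ ⟩
      count P? (interval m) + count P? (applyUpTo (λ i → suc (m + i)) n)
        ≤⟨ +-mono-≤ (count-applyUpTo-mono-≤ P? Q? head⇒ m) (count-applyUpTo-mono-≤ P? Q? tail⇒ n) ⟩
      count Q? (applyUpTo (λ i → suc (n + i)) m) + count Q? (interval n)
        ≡⟨ +-comm _ (count Q? (interval n)) ⟩
      count Q? (interval n) + count Q? (applyUpTo (λ i → suc (n + i)) m)
        ≡⟨ ∑-++ (𝟙 ∘ Q?) (interval n) _ ⟨
      count Q? (interval n ++ applyUpTo (λ i → suc (n + i)) m)
        ≡⟨ cong (count Q?) (applyUpTo-+ suc n m) ⟨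
      count Q? (interval (n + m)) ∎
      where open ≤-Reasoning

  module StrictOrderCounting {_≺_ : Rel A ℓ} (≺-trans : Transitive _≺_) (≺-irrefl : ∀ {x} → ¬ x ≺ x)
           (_≺?_ : B.Decidable _≺_) where

    above : List A → A → ℕ
    above L x = count (x ≺?_) L

    extract-maximal : ∀ x xs → ∃₂ λ m L → x ∷ xs ↭ m ∷ L × All (λ z → ¬ m ≺ z) (m ∷ L)
    extract-maximal x [] = x , [] , ↭-refl , ≺-irrefl ∷ []
    extract-maximal x (y ∷ ys) with extract-maximal y ys
    ... | m , L , y∷ys↭m∷L , m⊀ with m ≺? x
    ...   | yes m≺x = x , m ∷ L , prep x y∷ys↭m∷L ,
                      ≺-irrefl ∷ All.map (λ m⊀z x≺z → m⊀z (≺-trans m≺x x≺z)) m⊀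
    ...   | no  m⊀x = m , x ∷ L , ↭-trans (prep x y∷ys↭m∷L) (swap x m ↭-refl) ,
                      All.head m⊀ ∷ m⊀x ∷ All.tail m⊀

    above-↭ : ∀ {L M} → L ↭ M → ∀ x → above L x ≡ above M x
    above-↭ L↭M x = ∑-↭ (𝟙 ∘ (x ≺?_)) L↭M

    -- Peel off a maximal element: its own count is 0 and removing it lowers every other count by at most one.
    k*[1+k]≤2*∑[k∸above] : ∀ k L → k ≤ length L → k * suc k ≤ 2 * ∑ (λ x → k ∸ above L x) L
    k*[1+k]≤2*∑[k∸above] zero    L        _       = z≤n
    k*[1+k]≤2*∑[k∸above] (suc k) (x ∷ xs) 1+k≤len with extract-maximal x xs
    ... | m , L , x∷xs↭m∷L , m⊀ = begin
      suc k * suc (suc k)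
        ≡⟨ triangular-step k ⟩
      2 * suc k + k * suc k
        ≤⟨ +-monoʳ-≤ (2 * suc k) (k*[1+k]≤2*∑[k∸above] k L k≤len) ⟩
      2 * suc k + 2 * ∑ (λ y → k ∸ above L y) L
        ≡⟨ *-distribˡ-+ 2 (suc k) _ ⟨
      2 * (suc k + ∑ (λ y → k ∸ above L y) L)
        ≤⟨ *-monoʳ-≤ 2 (+-mono-≤ (≤-reflexive (cong (suc k ∸_) (sym above-m≡0)))
                                  (∑-mono-≤ L (λ {y} _ → ∸-monoʳ-≤ (suc k) (above-∷-≤ y)))) ⟩
      2 * ∑ (λ y → suc k ∸ above (m ∷ L) y) (m ∷ L)
        ≡⟨ cong (2 *_) (∑-↭ (λ y → suc k ∸ above (m ∷ L) y) x∷xs↭m∷L) ⟨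
      2 * ∑ (λ y → suc k ∸ above (m ∷ L) y) (x ∷ xs)
        ≡⟨ cong (2 *_) (∑-cong (λ y → cong (suc k ∸_) (above-↭ x∷xs↭m∷L y)) (x ∷ xs)) ⟨
      2 * ∑ (λ y → suc k ∸ above (x ∷ xs) y) (x ∷ xs) ∎
      where
      open ≤-Reasoning
      triangular-step : ∀ k → suc k * suc (suc k) ≡ 2 * suc k + k * suc k
      triangular-step = solve-∀
      k≤len : k ≤ length L
      k≤len = s≤s⁻¹ (subst (suc k ≤_) (↭-length x∷xs↭m∷L) 1+k≤len)
      above-m≡0 : above (m ∷ L) m ≡ 0
      above-m≡0 = count-none (m ≺?_) m⊀
      above-∷-≤ : ∀ y → above (m ∷ L) y ≤ suc (above L y)
      above-∷-≤ y = +-monoˡ-≤ (above L y) (𝟙≤1 (y ≺? m))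

  p<p+q : ∀ {p q} → 0ℚ ℚ.< q → p ℚ.< p ℚ.+ q
  p<p+q {p} {q} 0<q = subst (ℚ._< p ℚ.+ q) (ℚ.+-identityʳ p) (ℚ.+-monoʳ-< p 0<q)

  ∈-interval⇒≤ : ∀ {x a} → x ∈ interval a → x ≤ a
  ∈-interval⇒≤ x∈ with _ , i<a , refl ← ∈-applyUpTo⁻ suc x∈ = i<a

  module Rows (f : ℕ → ℚ) (a : ℕ) where
    I : List ℕ
    I = interval a

    positive? : Decidable (λ y → 0ℚ ℚ.< f y)
    positive? y = 0ℚ ℚ.<? f y

    additive? : ∀ x → Decidable (λ y → f (x + y) ≡ f x ℚ.+ f y)
    additive? x y = f (x + y) ℚ.≟ f x ℚ.+ f y

    nonadditive? : ∀ x → Decidable (λ y → ¬ f (x + y) ≡ f x ℚ.+ f y)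
    nonadditive? x = ∁? (additive? x)

    periodic? : Decidable (λ z → f (z + a) ≡ f z)
    periodic? z = f (z + a) ℚ.≟ f z

    above? : ∀ x → Decidable (λ z → f x ℚ.< f z)
    above? x z = f x ℚ.<? f z

    open StrictOrderCounting {_≺_ = λ x z → f x ℚ.< f z} ℚ.<-trans (ℚ.<-irrefl refl) above?
      using (above; k*[1+k]≤2*∑[k∸above])

    count-positive-additive≤ : ∀ x m → x + m ≡ a →
      count (positive? ∩? additive? x) I ≤ count (∁? periodic? ∪? above? x) I
    count-positive-additive≤ x m x+m≡a =
      subst₂ (λ b c → count (positive? ∩? additive? x) (interval b) ≤ count (∁? periodic? ∪? above? x) (interval c))
             (trans (+-comm m x) x+m≡a) x+m≡a
             (count-interval-rotate (positive? ∩? additive? x) (∁? periodic? ∪? above? x) m x head⇒ tail⇒)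
      where
      head⇒ : ∀ i → 0ℚ ℚ.< f (suc i) × f (x + suc i) ≡ f x ℚ.+ f (suc i) →
              ¬ f (suc (x + i) + a) ≡ f (suc (x + i)) ⊎ f x ℚ.< f (suc (x + i))
      head⇒ i (0<fy , additive) =
        inj₂ (subst (f x ℚ.<_) (trans (sym additive) (cong f (+-suc x i))) (p<p+q 0<fy))
      rearrange : ∀ x m i → x + suc (m + i) ≡ suc i + (x + m)
      rearrange = solve-∀
      wrap : ∀ i → x + suc (m + i) ≡ suc i + a
      wrap i = trans (rearrange x m i) (cong (suc i +_) x+m≡a)
      tail⇒ : ∀ i → 0ℚ ℚ.< f (suc (m + i)) × f (x + suc (m + i)) ≡ f x ℚ.+ f (suc (m + i)) →
              ¬ f (suc i + a) ≡ f (suc i) ⊎ f x ℚ.< f (suc i)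
      tail⇒ i (0<fy , additive) with periodic? (suc i)
      ... | no  ¬periodic = inj₁ ¬periodic
      ... | yes periodic  =
        inj₂ (subst (f x ℚ.<_) (trans (sym additive) (trans (cong f (wrap i)) periodic)) (p<p+q 0<fy))

    count-positive∸≤ : ∀ x → x ≤ a →
      count positive? I ∸ (count (∁? periodic?) I + above I x) ≤ count (positive? ∩? nonadditive? x) I
    count-positive∸≤ x x≤a with m , x+m≡a ← m≤n⇒∃[o]m+o≡n x≤a = m≤n+o⇒m∸n≤o _ _ (begin
      count positive? I
        ≡⟨ count-split positive? (additive? x) I ⟩
      count (positive? ∩? additive? x) I + count (positive? ∩? nonadditive? x) I
        ≤⟨ +-monoˡ-≤ _ (≤-trans (count-positive-additive≤ x m x+m≡a) (count-∪ (∁? periodic?) (above? x) I)) ⟩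
      count (∁? periodic?) I + above I x + count (positive? ∩? nonadditive? x) I ∎)
      where open ≤-Reasoning

    excess : ℕ
    excess = count positive? I ∸ count (∁? periodic?) I

    positivePairs : ℕ
    positivePairs = ∑ (λ x → count (positive? ∩? nonadditive? x) I) I

    excess*[1+excess]≤2*positivePairs : excess * suc excess ≤ 2 * positivePairs
    excess*[1+excess]≤2*positivePairs = begin
      excess * suc excess
        ≤⟨ k*[1+k]≤2*∑[k∸above] excess I (≤-trans (m∸n≤m _ np) (count≤length positive? I)) ⟩
      2 * ∑ (λ x → excess ∸ above I x) I
        ≤⟨ *-monoʳ-≤ 2 (∑-mono-≤ I λ {x} x∈I →
             ≤-trans (≤-reflexive (∸-+-assoc (count positive? I) np (above I x)))
                     (count-positive∸≤ x (∈-interval⇒≤ x∈I))) ⟩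
      2 * positivePairs ∎
      where
      open ≤-Reasoning
      np = count (∁? periodic?) I

  2*m*n≤m*m+n*n : ∀ m n → 2 * (m * n) ≤ m * m + n * n
  2*m*n≤m*m+n*n zero    n       = z≤n
  2*m*n≤m*m+n*n (suc m) zero    rewrite *-zeroʳ m = z≤n
  2*m*n≤m*m+n*n (suc m) (suc n) =
    subst₂ _≤_ (sym (lhs m n)) (sym (rhs m n)) (+-monoˡ-≤ (2 * m + 2 * n + 2) (2*m*n≤m*m+n*n m n))
    where
    lhs : ∀ m n → 2 * (suc m * suc n) ≡ 2 * (m * n) + (2 * m + 2 * n + 2)
    lhs = solve-∀
    rhs : ∀ m n → suc m * suc m + suc n * suc n ≡ m * m + n * n + (2 * m + 2 * n + 2)
    rhs = solve-∀

  [m+n]*[m+n+2]≤2*[m*[1+m]+n*[1+n]] : ∀ m n → (m + n) * (m + n + 2) ≤ 2 * (m * suc m + n * suc n)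
  [m+n]*[m+n+2]≤2*[m*[1+m]+n*[1+n]] m n =
    subst₂ _≤_ (sym (lhs m n)) (sym (rhs m n)) (+-monoʳ-≤ (m * m + n * n + 2 * m + 2 * n) (2*m*n≤m*m+n*n m n))
    where
    lhs : ∀ m n → (m + n) * (m + n + 2) ≡ m * m + n * n + 2 * m + 2 * n + 2 * (m * n)
    lhs = solve-∀
    rhs : ∀ m n → 2 * (m * suc m + n * suc n) ≡ m * m + n * n + 2 * m + 2 * n + (m * m + n * n)
    rhs = solve-∀

  positive∧negated-positive⇒⊥ : ∀ {r} → 0ℚ ℚ.< r → 0ℚ ℚ.< ℚ.- r → ⊥
  positive∧negated-positive⇒⊥ 0<r 0<-r = ℚ.<-asym (ℚ.neg-antimono-< 0<r) 0<-r

  sign-trichotomy : ∀ r → 0ℚ ℚ.< r ⊎ 0ℚ ℚ.< ℚ.- r ⊎ r ≡ 0ℚ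
  sign-trichotomy r with ℚ.<-cmp r 0ℚ
  ... | tri< r<0 _ _ = inj₂ (inj₁ (ℚ.neg-antimono-< r<0))
  ... | tri≈ _ r≡0 _ = inj₂ (inj₂ r≡0)
  ... | tri> _ _ 0<r = inj₁ 0<r

  module Bounds (f : ℕ → ℚ) (a : ℕ) where
    module ⁺ = Rows f a
    module ⁻ = Rows (λ y → ℚ.- f y) a
    open ⁺ using (I)

    zero? : Decidable (λ y → f y ≡ 0ℚ)
    zero? y = f y ℚ.≟ 0ℚ

    W : ℕ
    W = ⁺.excess + ⁻.excess

    |P|≡∑nonadditive : length (P f a) ≡ ∑ (λ x → count (⁺.nonadditive? x) I) I
    |P|≡∑nonadditive = trans (length-filter≡count _ (cartesianProduct I I))
                             (count-cartesianProduct (λ (x , y) → ⁺.nonadditive? x y) I I)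

    positivePairs⁺+positivePairs⁻≤|P| : ⁺.positivePairs + ⁻.positivePairs ≤ length (P f a)
    positivePairs⁺+positivePairs⁻≤|P| = begin
      ⁺.positivePairs + ⁻.positivePairs
        ≡⟨ ∑-+ (λ x → count (⁺.positive? ∩? ⁺.nonadditive? x) I) (λ x → count (⁻.positive? ∩? ⁻.nonadditive? x) I) I ⟨
      ∑ (λ x → count (⁺.positive? ∩? ⁺.nonadditive? x) I + count (⁻.positive? ∩? ⁻.nonadditive? x) I) I
        ≤⟨ ∑-mono-≤ I (λ {x} _ → row-by-sign x) ⟩
      ∑ (λ x → count (⁺.nonadditive? x) I) I
        ≡⟨ |P|≡∑nonadditive ⟨
      length (P f a) ∎
      where
      open ≤-Reasoning
      row-by-sign : ∀ x → count (⁺.positive? ∩? ⁺.nonadditive? x) I + count (⁻.positive? ∩? ⁻.nonadditive? x) I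
                            ≤ count (⁺.nonadditive? x) I
      row-by-sign x =
        count-disjoint (⁺.positive? ∩? ⁺.nonadditive? x) (⁻.positive? ∩? ⁻.nonadditive? x) (⁺.nonadditive? x)
          (λ (0<fy , _) (0<-fy , _) → positive∧negated-positive⇒⊥ 0<fy 0<-fy)
          proj₂
          (λ {y} (_ , nonadditive⁻) additive →
             nonadditive⁻ (trans (cong ℚ.-_ additive) (ℚ.neg-distrib-+ (f x) (f y))))
          I

    W*[W+2]≤4*|P| : W * (W + 2) ≤ 4 * length (P f a)
    W*[W+2]≤4*|P| = begin
      W * (W + 2)
        ≤⟨ [m+n]*[m+n+2]≤2*[m*[1+m]+n*[1+n]] ⁺.excess ⁻.excess ⟩
      2 * (⁺.excess * suc ⁺.excess + ⁻.excess * suc ⁻.excess)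
        ≤⟨ *-monoʳ-≤ 2 (+-mono-≤ ⁺.excess*[1+excess]≤2*positivePairs ⁻.excess*[1+excess]≤2*positivePairs) ⟩
      2 * (2 * ⁺.positivePairs + 2 * ⁻.positivePairs)
        ≡⟨ double-double ⁺.positivePairs ⁻.positivePairs ⟩
      4 * (⁺.positivePairs + ⁻.positivePairs)
        ≤⟨ *-monoʳ-≤ 4 positivePairs⁺+positivePairs⁻≤|P| ⟩
      4 * length (P f a) ∎
      where
      open ≤-Reasoning
      double-double : ∀ m n → 2 * (2 * m + 2 * n) ≡ 4 * (m + n)
      double-double = solve-∀

    a≤positive⁺+positive⁻+zero : a ≤ count ⁺.positive? I + count ⁻.positive? I + count zero? I
    a≤positive⁺+positive⁻+zero = begin
      a
        ≡⟨ length-applyUpTo suc a ⟨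
      length I
        ≡⟨ count-universal (⁺.positive? ∪? ⁻.positive? ∪? zero?) (λ y → sign-trichotomy (f y)) I ⟨
      count (⁺.positive? ∪? ⁻.positive? ∪? zero?) I
        ≤⟨ count-∪ ⁺.positive? (⁻.positive? ∪? zero?) I ⟩
      count ⁺.positive? I + count (⁻.positive? ∪? zero?) I
        ≤⟨ +-monoʳ-≤ (count ⁺.positive? I) (count-∪ ⁻.positive? zero? I) ⟩
      count ⁺.positive? I + (count ⁻.positive? I + count zero? I)
        ≡⟨ +-assoc (count ⁺.positive? I) _ _ ⟨
      count ⁺.positive? I + count ⁻.positive? I + count zero? I ∎
      where open ≤-Reasoning

    a≤W+|Z|+2|NP| : a ≤ W + length (Z f a) + length (NP f a) + length (NP f a)
    a≤W+|Z|+2|NP| = begin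
      a
        ≤⟨ a≤positive⁺+positive⁻+zero ⟩
      count ⁺.positive? I + count ⁻.positive? I + z
        ≤⟨ +-monoˡ-≤ z (+-mono-≤ (m≤n+m∸n (count ⁺.positive? I) np) positive⁻≤np+excess⁻) ⟩
      np + ⁺.excess + (np + ⁻.excess) + z
        ≡⟨ rearrange np ⁺.excess ⁻.excess z ⟩
      W + z + np + np
        ≡⟨ cong₂ (λ z np → W + z + np + np) (length-filter≡count zero? I) (length-filter≡count (∁? ⁺.periodic?) I) ⟨
      W + length (Z f a) + length (NP f a) + length (NP f a) ∎
      where
      open ≤-Reasoning
      z = count zero? I
      np = count (∁? ⁺.periodic?) I
      np⁻≤np : count (∁? ⁻.periodic?) I ≤ np
      np⁻≤np = count-mono-≤ (∁? ⁻.periodic?) (∁? ⁺.periodic?) (λ aperiodic⁻ periodic → aperiodic⁻ (cong ℚ.-_ periodic)) I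
      positive⁻≤np+excess⁻ : count ⁻.positive? I ≤ np + ⁻.excess
      positive⁻≤np+excess⁻ = ≤-trans (m≤n+m∸n (count ⁻.positive? I) (count (∁? ⁻.periodic?) I)) (+-monoˡ-≤ ⁻.excess np⁻≤np)
      rearrange : ∀ n u v z → n + u + (n + v) + z ≡ u + v + z + n + n
      rearrange = solve-∀

open import Defs
open import Data.Nat using (ℕ; _≤_)
open import Data.List using (length)
open import Data.Rational using (ℚ; 0ℚ; 1ℚ; ½; _+_; _-_; _*_) renaming (_≤_ to _≤ℚ_; _<_ to _<ℚ_)

import Data.Nat as ℕ
import Data.Integer as ℤ
import Data.Integer.Properties as ℤ
open import Data.Integer using (+_)
open import Data.Nat.Coprimality using (1-coprimeTo; sym)
open import Data.Rational using (toℚᵘ; -_; nonNegative)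
open import Data.Rational.Properties
  using ( normalize-coprime; toℚᵘ-injective; toℚᵘ-homo-+; toℚᵘ-homo-*; toℚᵘ-cancel-≤; ≤-refl; ≤-trans; <⇒≤
        ; +-mono-≤; +-monoˡ-≤; +-monoʳ-≤; +-mono-<; *-monoʳ-≤-nonNeg; *-monoˡ-≤-nonNeg; module ≤-Reasoning)
open import Data.Rational.Solver using (module +-*-Solver)
open import Data.Rational.Unnormalised as ℚᵘ using (mkℚᵘ; *≤*) renaming (_+_ to _+ᵘ_; _*_ to _*ᵘ_)
import Data.Rational.Unnormalised.Properties as ℚᵘ
open import Relation.Binary.PropositionalEquality using (_≡_; refl; trans; cong; cong₂; subst₂) renaming (sym to ≡-sym)

open Combinatorics using (module Bounds)

toℚᵘ∘toℚ : ∀ n → toℚᵘ (toℚ n) ≡ mkℚᵘ (+ n) 0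
toℚᵘ∘toℚ n = cong toℚᵘ (normalize-coprime (sym (1-coprimeTo n)))

toℚ-+ : ∀ m n → toℚ (m ℕ.+ n) ≡ toℚ m + toℚ n
toℚ-+ m n = toℚᵘ-injective (begin
  toℚᵘ (toℚ (m ℕ.+ n))             ≡⟨ toℚᵘ∘toℚ (m ℕ.+ n) ⟩
  mkℚᵘ (+ (m ℕ.+ n)) 0             ≡⟨ cong (λ k → mkℚᵘ k 0) (ℤ.pos-+ m n) ⟩
  mkℚᵘ (+ m ℤ.+ + n) 0             ≡⟨ cong (λ k → mkℚᵘ k 0) (cong₂ ℤ._+_ (ℤ.*-identityʳ (+ m)) (ℤ.*-identityʳ (+ n))) ⟨
  mkℚᵘ (+ m) 0 +ᵘ mkℚᵘ (+ n) 0     ≡⟨ cong₂ _+ᵘ_ (toℚᵘ∘toℚ m) (toℚᵘ∘toℚ n) ⟨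
  toℚᵘ (toℚ m) +ᵘ toℚᵘ (toℚ n)     ≈⟨ toℚᵘ-homo-+ (toℚ m) (toℚ n) ⟨
  toℚᵘ (toℚ m + toℚ n)             ∎)
  where open ℚᵘ.≃-Reasoning

toℚ-* : ∀ m n → toℚ (m ℕ.* n) ≡ toℚ m * toℚ n
toℚ-* m n = toℚᵘ-injective (begin
  toℚᵘ (toℚ (m ℕ.* n))             ≡⟨ toℚᵘ∘toℚ (m ℕ.* n) ⟩
  mkℚᵘ (+ (m ℕ.* n)) 0             ≡⟨ cong (λ k → mkℚᵘ k 0) (ℤ.pos-* m n) ⟩
  mkℚᵘ (+ m) 0 *ᵘ mkℚᵘ (+ n) 0     ≡⟨ cong₂ _*ᵘ_ (toℚᵘ∘toℚ m) (toℚᵘ∘toℚ n) ⟨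
  toℚᵘ (toℚ m) *ᵘ toℚᵘ (toℚ n)     ≈⟨ toℚᵘ-homo-* (toℚ m) (toℚ n) ⟨
  toℚᵘ (toℚ m * toℚ n)             ∎)
  where open ℚᵘ.≃-Reasoning

toℚ-mono-≤ : ∀ {m n} → m ≤ n → toℚ m ≤ℚ toℚ n
toℚ-mono-≤ {m} {n} m≤n = toℚᵘ-cancel-≤ (subst₂ ℚᵘ._≤_ (≡-sym (toℚᵘ∘toℚ m)) (≡-sym (toℚᵘ∘toℚ n))
  (*≤* (subst₂ ℤ._≤_ (≡-sym (ℤ.*-identityʳ (+ m))) (≡-sym (ℤ.*-identityʳ (+ n))) (ℤ.+≤+ m≤n))))

open +-*-Solver

toℚ-nonNeg : ∀ n → 0ℚ ≤ℚ toℚ n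
toℚ-nonNeg n = toℚ-mono-≤ {n = n} ℕ.z≤n

*-mono-≤-nonNeg : ∀ {p q r s} → 0ℚ ≤ℚ p → 0ℚ ≤ℚ r → p ≤ℚ q → r ≤ℚ s → p * r ≤ℚ q * s
*-mono-≤-nonNeg {p} {q} {r} {s} 0≤p 0≤r p≤q r≤s = begin
  p * r ≤⟨ *-monoʳ-≤-nonNeg r {{nonNegative 0≤r}} p≤q ⟩
  q * r ≤⟨ *-monoˡ-≤-nonNeg q {{nonNegative (≤-trans 0≤p p≤q)}} r≤s ⟩
  q * s ∎
  where open ≤-Reasoning

0≤r-[p+p] : ∀ p r → p <ℚ ½ * r → 0ℚ ≤ℚ r - (p + p)
0≤r-[p+p] p r p<½r = begin
  0ℚ                         ≡⟨ solve 1 (λ s → con 0ℚ := s :- s) refl (p + p) ⟩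
  (p + p) - (p + p)          ≤⟨ +-monoˡ-≤ (- (p + p)) (<⇒≤ (+-mono-< p<½r p<½r)) ⟩
  (½ * r + ½ * r) - (p + p)  ≡⟨ solve 2 (λ r s → (con ½ :* r :+ con ½ :* r) :- s := r :- s) refl r (p + p) ⟩
  r - (p + p)                ∎
  where open ≤-Reasoning

[1-q-2p]*a≤W : ∀ (a W z np : ℕ) (p q : ℚ) → toℚ z ≤ℚ q * toℚ a → toℚ np ≤ℚ p * toℚ a →
               a ≤ W ℕ.+ z ℕ.+ np ℕ.+ np → (1ℚ - q - (p + p)) * toℚ a ≤ℚ toℚ W
[1-q-2p]*a≤W a W z np p q z≤qa np≤pa a≤W+z+2np = begin
  (1ℚ - q - (p + p)) * A       ≡⟨ solve 3 (λ p q A → (con 1ℚ :- q :- (p :+ p)) :* A := A :- (q :* A :+ p :* A :+ p :* A))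
                                          refl p q A ⟩
  A - d                        ≤⟨ +-monoˡ-≤ (- d) A≤w+d ⟩
  (w + q * A + p * A + p * A) - d
                               ≡⟨ solve 4 (λ w x y z → (w :+ x :+ y :+ z) :- (x :+ y :+ z) := w) refl w (q * A) (p * A) (p * A) ⟩
  w                            ∎
  where
  open ≤-Reasoning
  A = toℚ a
  w = toℚ W
  d = q * A + p * A + p * A
  A≤w+d : A ≤ℚ w + q * A + p * A + p * A
  A≤w+d = begin
    A                            ≤⟨ toℚ-mono-≤ a≤W+z+2np ⟩
    toℚ (W ℕ.+ z ℕ.+ np ℕ.+ np)  ≡⟨ trans (toℚ-+ (W ℕ.+ z ℕ.+ np) np)
                                      (cong (_+ toℚ np) (trans (toℚ-+ (W ℕ.+ z) np) (cong (_+ toℚ np) (toℚ-+ W z)))) ⟩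
    w + toℚ z + toℚ np + toℚ np  ≤⟨ +-mono-≤ (+-mono-≤ (+-monoʳ-≤ w z≤qa) np≤pa) np≤pa ⟩
    w + q * A + p * A + p * A    ∎

quadratic-lower-bound : ∀ c A (W N : ℕ) → 0ℚ ≤ℚ c → 0ℚ ≤ℚ A → c * A ≤ℚ toℚ W →
                        W ℕ.* (W ℕ.+ 2) ≤ 4 ℕ.* N → (c * c * ½ * ½) * (A * A) + (c * ½) * A ≤ℚ toℚ N
quadratic-lower-bound c A W N 0≤c 0≤A cA≤W W*[W+2]≤4N = begin
  (c * c * ½ * ½) * (A * A) + (c * ½) * A
    ≡⟨ solve 2 (λ c A → (c :* c :* con ½ :* con ½) :* (A :* A) :+ (c :* con ½) :* A
                       := (c :* A) :* (c :* A :+ con (toℚ 2)) :* con ½ :* con ½) refl c A ⟩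
  c * A * (c * A + toℚ 2) * ½ * ½
    ≤⟨ *-monoʳ-≤-nonNeg ½ (*-monoʳ-≤-nonNeg ½ (*-mono-≤-nonNeg 0≤cA 0≤cA+2 cA≤W (+-monoˡ-≤ (toℚ 2) cA≤W))) ⟩
  toℚ W * (toℚ W + toℚ 2) * ½ * ½
    ≡⟨ cong (λ r → r * ½ * ½) (trans (toℚ-* W (W ℕ.+ 2)) (cong (toℚ W *_) (toℚ-+ W 2))) ⟨
  toℚ (W ℕ.* (W ℕ.+ 2)) * ½ * ½
    ≤⟨ *-monoʳ-≤-nonNeg ½ (*-monoʳ-≤-nonNeg ½ (toℚ-mono-≤ W*[W+2]≤4N)) ⟩
  toℚ (4 ℕ.* N) * ½ * ½
    ≡⟨ cong (λ r → r * ½ * ½) (toℚ-* 4 N) ⟩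
  toℚ 4 * toℚ N * ½ * ½
    ≡⟨ solve 1 (λ n → con (toℚ 4) :* n :* con ½ :* con ½ := n) refl (toℚ N) ⟩
  toℚ N ∎
  where
  open ≤-Reasoning
  0≤cA : 0ℚ ≤ℚ c * A
  0≤cA = *-mono-≤-nonNeg ≤-refl ≤-refl 0≤c 0≤A
  0≤cA+2 : 0ℚ ≤ℚ c * A + toℚ 2
  0≤cA+2 = +-mono-≤ 0≤cA (toℚ-nonNeg 2)

mainTheorem5 : (a : ℕ) → 1 ≤ a → (p q : ℚ) →
    0ℚ ≤ℚ p → p ≤ℚ 1ℚ → 0ℚ ≤ℚ q → q ≤ℚ 1ℚ →
    p <ℚ ½ * (1ℚ - q) →
    (f : ℕ → ℚ) →
    toℚ (length (Z f a)) ≤ℚ q * toℚ a →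
    toℚ (length (NP f a)) ≤ℚ p * toℚ a →
    ((1ℚ - q - (p + p)) * (1ℚ - q - (p + p)) * ½ * ½) * (toℚ a * toℚ a)
      + ((1ℚ - q - (p + p)) * ½) * toℚ a
      ≤ℚ toℚ (length (P f a))
mainTheorem5 a _ p q _ _ _ _ p<½[1-q] f |Z|≤qa |NP|≤pa =
  quadratic-lower-bound (1ℚ - q - (p + p)) (toℚ a) W (length (P f a))
    (0≤r-[p+p] p (1ℚ - q) p<½[1-q]) (toℚ-nonNeg a)
    ([1-q-2p]*a≤W a W (length (Z f a)) (length (NP f a)) p q |Z|≤qa |NP|≤pa a≤W+|Z|+2|NP|)
    W*[W+2]≤4*|P|
  where open Bounds f a
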